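{- Let $k\ge1$, let $t_1,\dots,t_k$ be variables with the convention $t_j=0$ for $j>k$, and let $\omega=(\omega_1,\omega_2,\dots)$ be integers. For $m\ge1$ let $M_m=\operatorname{perm}H_{+}^{(m)}$, where $H_{+}^{(m)}$ is the $m\times m$ matrix $(h_{ij})$ with, for $1\le i\le m-1$, $h_{ij}=t_{i-j+1}$ if $j\le i$, $h_{i,i+1}=1$, $h_{ij}=0$ if $j>i+1$, and last row $h_{mj}=\omega_{m-j+1}t_{m-j+1}$ ($1\le j\le m$). Then for every $n\ge2$, $$M_n=t_1M_{n-1}+t_2M_{n-2}+\cdots+t_{n-1}M_1+\omega_nt_n.$$
   Context: The permanent of a square matrix $M=(m_{ij})_{1\le i,j\le n}$ is $\operatorname{perm}M=\sum_{\sigma\in S_n}\prod_{i} m_{i\sigma(i)}$. For $m=1$, $H_+^{(1)}$ is the $1\times1$ matrix $(\omega_1t_1)$. -}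

module Defs where

open import Level using (Level)
open import Algebra.Bundles using (CommutativeRing)
open import Data.Nat using (ℕ; zero; suc; _∸_; _≟_; _≤?_)
open import Data.Integer using (ℤ; +_; -[1+_])
open import Data.Fin using (Fin; toℕ) renaming (zero to fzero; suc to fsuc)
import Data.Fin as F
open import Data.List using (List; []; _∷_; [_]; map; concatMap; foldr; filterᵇ; allFin; upTo)
import Data.List as L
open import Data.Bool using (Bool; true; false; _∧_; _∨_; if_then_else_; not)
open import Relation.Nullary.Decidable using (⌊_⌋)
import Relation.Nullary

allFuns : (n m : ℕ) → List (Fin n → Fin m)
allFuns zero    m = [ (λ ()) ]
allFuns (suc n) m =
  concatMap (λ f → map (λ a → λ { fzero → a ; (fsuc i) → f i }) (allFin m)) (allFuns n m)

allᵇ : {A : Set} → (A → Bool) → List A → Bool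
allᵇ p = foldr (λ a b → p a ∧ b) true

-- σ : Fin n → Fin n is injective (hence a permutation); decided by checking all pairs
isPermᵇ : {n : ℕ} → (Fin n → Fin n) → Bool
isPermᵇ {n} σ =
  allᵇ (λ i → allᵇ (λ j → ⌊ i F.≟ j ⌋ ∨ not ⌊ σ i F.≟ σ j ⌋) (allFin n)) (allFin n)

permutations : (n : ℕ) → List (Fin n → Fin n)
permutations n = filterᵇ isPermᵇ (allFuns n n)

module _ {c ℓ : Level} (R : CommutativeRing c ℓ) where
  open CommutativeRing R

  sumR : List Carrier → Carrier
  sumR = foldr _+_ 0#

  prodR : List Carrier → Carrier
  prodR = foldr _*_ 1#

  perm : {n : ℕ} → (Fin n → Fin n → Carrier) → Carrier
  perm {n} M = sumR (map (λ σ → prodR (map (λ i → M i (σ i)) (allFin n))) (permutations n))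

  natR : ℕ → Carrier
  natR zero    = 0#
  natR (suc n) = 1# + natR n

  intR : ℤ → Carrier
  intR (+ n)      = natR n
  intR -[1+ n ]   = - natR (suc n)

  -- H_+^{(m)} with 1-based indices ii = toℕ i + 1, jj = toℕ j + 1;
  -- t : ℕ → Carrier is indexed so that t j is t_j (t 0 is never used), ω j is ω_j.
  Hplus : (t : ℕ → Carrier) (ω : ℕ → ℤ) (m : ℕ) → Fin m → Fin m → Carrier
  Hplus t ω m i j with suc (toℕ i) ≟ m
  ... | Relation.Nullary.yes _ = intR (ω (m ∸ toℕ j)) * t (m ∸ toℕ j)
  ... | Relation.Nullary.no _ with toℕ j ≤? toℕ i
  ...   | Relation.Nullary.yes _ = t (suc (toℕ i ∸ toℕ j))
  ...   | Relation.Nullary.no _ with toℕ j ≟ suc (toℕ i)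
  ...     | Relation.Nullary.yes _ = 1#
  ...     | Relation.Nullary.no _ = 0#

  Mseq : (t : ℕ → Carrier) (ω : ℕ → ℤ) (m : ℕ) → Carrier
  Mseq t ω m = perm (Hplus t ω m)

  recRHS : (t : ℕ → Carrier) (ω : ℕ → ℤ) (n : ℕ) → Carrier
  recRHS t ω n =
    sumR (map (λ i → t (suc i) * Mseq t ω (n ∸ suc i)) (upTo (n ∸ 1))) + intR (ω n) * t n

{-# OPTIONS --safe #-}
-- Expand the permanent along the first row. For n ≥ 2 the first row of H₊⁽ⁿ⁾ is
-- (t₁, 1, 0, …, 0); deleting its first column leaves H₊⁽ⁿ⁻¹⁾, and deleting its second
-- column leaves H₊⁽ⁿ⁻¹⁾ with its first column replaced by the rest of the first column
-- of H₊⁽ⁿ⁾. So if H₊⁽ⁿ⁾ is given an arbitrary first column (c₁, …, cₙ), the expansion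
-- perm = c₁ M_{n-1} + perm(H₊⁽ⁿ⁻¹⁾ with first column (c₂, …, cₙ)) unrolls to
-- c₁ M_{n-1} + ⋯ + c_{n-1} M₁ + cₙ, and the true first column (t₁, …, t_{n-1}, ωₙ tₙ)
-- gives the recurrence.
-- The row expansion itself holds for the permanent of a rectangular matrix, a sum over
-- injections, which is what makes it provable by induction on the number of rows.
module Submission where

open import Defs
open import Level using (Level)
open import Algebra.Bundles using (CommutativeRing)
open import Data.Bool using (Bool; true; false; _∧_; _∨_; not; if_then_else_)
open import Data.Bool.Properties using (∧-commutativeMonoid; ∧-assoc; ∧-idem; ∧-identityʳ; ∧-zeroʳ)
open import Data.Fin using (Fin; toℕ; punchIn; inject₁; fromℕ) renaming (zero to fzero; suc to fsuc)
import Data.Fin.Properties as Fin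
open import Data.Integer using (ℤ)
open import Data.List using (List; []; _∷_; _++_; map; concatMap; foldr; filterᵇ; allFin; applyUpTo; tabulate)
open import Data.List.Properties using (map-∘; foldr-map)
open import Data.Nat using (ℕ; zero; suc; _∸_; _≤_; _<_; s≤s; z≤n)
open import Data.Nat.Properties using (_≟_; _≤?_; ≡-irrelevant; ≤-irrelevant; suc-injective; ≤-pred)
open import Data.Vec.Functional as Vector using (removeAt) renaming (_∷_ to _∷ᶠ_)
open import Function using (_∘_; id)
open import Function.Bundles using (mk⇔)
open import Relation.Binary.Core using (_Preserves_⟶_)
open import Relation.Binary.PropositionalEquality as ≡ using (_≡_; _≢_; _≗_)
open import Relation.Nullary using (¬_; does; yes; no; contradiction)
open import Relation.Nullary.Decidable using (⌊_⌋; isYes≗does; does-⇔; dec-yes-irr; dec-no)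

open import Algebra.Properties.CommutativeMonoid.Sum ∧-commutativeMonoid
  using () renaming (sum to ⋀; sum-cong-≗ to ⋀-cong; ∑-distrib-+ to ⋀-distrib-∧)

private variable
  ℓ₁ ℓ₂ : Level
  n m : ℕ
  A B : Set

foldr-map-tabulate : {X : Set ℓ₁} {Y Z : Set ℓ₂} (f : Y → Z → Z) (e : Z) (g : X → Y) (h : Fin n → X) →
                     foldr f e (map g (tabulate h)) ≡ Vector.foldr f e (g ∘ h)
foldr-map-tabulate {n = zero}  f e g h = ≡.refl
foldr-map-tabulate {n = suc n} f e g h = ≡.cong (f (g (h fzero))) (foldr-map-tabulate f e g (h ∘ fsuc))

allᵇ-allFin : (p : Fin n → Bool) → allᵇ p (allFin n) ≡ ⋀ p
allᵇ-allFin p = ≡.trans (≡.sym (foldr-map _∧_ p true (allFin _))) (foldr-map-tabulate _∧_ true p id)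

does-≟-sym : (x y : Fin n) → does (x Fin.≟ y) ≡ does (y Fin.≟ x)
does-≟-sym x y = does-⇔ (mk⇔ ≡.sym ≡.sym) (x Fin.≟ y) (y Fin.≟ x)

does-≟-punchIn : (a : Fin (suc n)) (x y : Fin n) → does (punchIn a x Fin.≟ punchIn a y) ≡ does (x Fin.≟ y)
does-≟-punchIn a x y = does-⇔ (mk⇔ (Fin.punchIn-injective a x y) (≡.cong (punchIn a)))
  (punchIn a x Fin.≟ punchIn a y) (x Fin.≟ y)

injectiveᵇ : (Fin n → Fin m) → Bool
injectiveᵇ f = ⋀ λ i → ⋀ λ j → does (i Fin.≟ j) ∨ not (does (f i Fin.≟ f j))

avoidsᵇ : Fin m → (Fin n → Fin m) → Bool
avoidsᵇ a f = ⋀ λ i → not (does (a Fin.≟ f i))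

isPermᵇ≡injectiveᵇ : (σ : Fin n → Fin n) → isPermᵇ σ ≡ injectiveᵇ σ
isPermᵇ≡injectiveᵇ {n} σ = ≡.trans (allᵇ-allFin λ i → allᵇ (entry i) (allFin n)) (⋀-cong λ i →
  ≡.trans (allᵇ-allFin (entry i)) (⋀-cong λ j →
    ≡.cong₂ (λ x y → x ∨ not y) (isYes≗does (i Fin.≟ j)) (isYes≗does (σ i Fin.≟ σ j))))
  where
  entry : Fin n → Fin n → Bool
  entry i j = ⌊ i Fin.≟ j ⌋ ∨ not ⌊ σ i Fin.≟ σ j ⌋

injectiveᵇ-cong : {f g : Fin n → Fin m} → f ≗ g → injectiveᵇ f ≡ injectiveᵇ g
injectiveᵇ-cong f≗g = ⋀-cong λ i → ⋀-cong λ j →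
  ≡.cong₂ (λ x y → does (i Fin.≟ j) ∨ not (does (x Fin.≟ y))) (f≗g i) (f≗g j)

avoidsᵇ-cong : (a : Fin m) {f g : Fin n → Fin m} → f ≗ g → avoidsᵇ a f ≡ avoidsᵇ a g
avoidsᵇ-cong a f≗g = ⋀-cong λ i → ≡.cong (λ x → not (does (a Fin.≟ x))) (f≗g i)

injectiveᵇ-∷ : (a : Fin m) (g : Fin n → Fin m) → injectiveᵇ (a ∷ᶠ g) ≡ avoidsᵇ a g ∧ injectiveᵇ g
injectiveᵇ-∷ {n = n} a g = begin
  avoidsᵇ a g ∧ ⋀ (λ i → not (does (g i Fin.≟ a)) ∧ row i)
    ≡⟨ ≡.cong (avoidsᵇ a g ∧_) (⋀-distrib-∧ _ row) ⟩
  avoidsᵇ a g ∧ (⋀ (λ i → not (does (g i Fin.≟ a))) ∧ injectiveᵇ g)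
    ≡⟨ ≡.cong (λ b → avoidsᵇ a g ∧ (b ∧ injectiveᵇ g)) (⋀-cong λ i → ≡.cong not (does-≟-sym (g i) a)) ⟩
  avoidsᵇ a g ∧ (avoidsᵇ a g ∧ injectiveᵇ g)
    ≡⟨ ≡.sym (∧-assoc (avoidsᵇ a g) _ _) ⟩
  (avoidsᵇ a g ∧ avoidsᵇ a g) ∧ injectiveᵇ g
    ≡⟨ ≡.cong (_∧ injectiveᵇ g) (∧-idem (avoidsᵇ a g)) ⟩
  avoidsᵇ a g ∧ injectiveᵇ g ∎
  where
  open ≡.≡-Reasoning
  row : Fin n → Bool
  row i = ⋀ λ j → does (i Fin.≟ j) ∨ not (does (g i Fin.≟ g j))

injectiveᵇ-punchIn : (a : Fin (suc m)) (h : Fin n → Fin m) → injectiveᵇ (punchIn a ∘ h) ≡ injectiveᵇ h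
injectiveᵇ-punchIn a h = ⋀-cong λ i → ⋀-cong λ j →
  ≡.cong (λ b → does (i Fin.≟ j) ∨ not b) (does-≟-punchIn a (h i) (h j))

module _ {r ℓ : Level} (R : CommutativeRing r ℓ) where
  open CommutativeRing R hiding (zero)
  open import Algebra.Properties.Semiring.Sum semiring
    using (sum; sum-syntax; sum-cong-≋; sum-remove; sum-replicate-zero; ∑-distrib-+)
  open import Algebra.Properties.Monoid.Sum *-monoid
    using () renaming (sum to ∏; sum-cong-≋ to ∏-cong)
  open import Relation.Binary.Reasoning.Setoid setoid

  guard : Bool → Carrier → Carrier
  guard b x = if b then x else 0#

  guard-congʳ : ∀ b {x y} → x ≈ y → guard b x ≈ guard b y
  guard-congʳ true  x≈y = x≈y
  guard-congʳ false _   = refl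

  ∑-guard-∧ʳ : ∀ (p : Fin n → Bool) b (x : Fin n → Carrier) →
               ∑[ i < n ] guard (p i ∧ b) (x i) ≈ guard b (∑[ i < n ] guard (p i) (x i))
  ∑-guard-∧ʳ p true  x = sum-cong-≋ λ i → reflexive (≡.cong (λ q → guard q (x i)) (∧-identityʳ (p i)))
  ∑-guard-∧ʳ {n} p false x = trans
    (sum-cong-≋ λ i → reflexive (≡.cong (λ q → guard q (x i)) (∧-zeroʳ (p i))))
    (sum-replicate-zero n)

  ∑-guard-≢ : (a : Fin (suc n)) (x : Fin (suc n) → Carrier) →
              ∑[ i < suc n ] guard (not (does (a Fin.≟ i))) (x i) ≈ ∑[ j < n ] x (punchIn a j)
  ∑-guard-≢ {n} a x = begin
    sum y                    ≈⟨ sum-remove {i = a} y ⟩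
    y a + sum (removeAt y a) ≈⟨ +-cong y-at-a (sum-cong-≋ y-punchIn) ⟩
    0# + sum (x ∘ punchIn a) ≈⟨ +-identityˡ _ ⟩
    sum (x ∘ punchIn a)      ∎
    where
    y : Fin (suc n) → Carrier
    y i = guard (not (does (a Fin.≟ i))) (x i)
    y-at-a : y a ≈ 0#
    y-at-a with a Fin.≟ a
    ... | yes _   = refl
    ... | no a≢a = contradiction ≡.refl a≢a
    y-punchIn : ∀ j → y (punchIn a j) ≈ x (punchIn a j)
    y-punchIn j with a Fin.≟ punchIn a j
    ... | yes a≡a↑j = contradiction (≡.sym a≡a↑j) (Fin.punchInᵢ≢i a j)
    ... | no _      = refl

  ∑ₗ : (A → Carrier) → List A → Carrier
  ∑ₗ f xs = sumR R (map f xs)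

  ∑ₗ-cong : {f g : A → Carrier} (xs : List A) → (∀ x → f x ≈ g x) → ∑ₗ f xs ≈ ∑ₗ g xs
  ∑ₗ-cong []       _   = refl
  ∑ₗ-cong (x ∷ xs) f≈g = +-cong (f≈g x) (∑ₗ-cong xs f≈g)

  ∑ₗ-++ : (f : A → Carrier) (xs ys : List A) → ∑ₗ f (xs ++ ys) ≈ ∑ₗ f xs + ∑ₗ f ys
  ∑ₗ-++ f []       ys = sym (+-identityˡ _)
  ∑ₗ-++ f (x ∷ xs) ys = trans (+-congˡ (∑ₗ-++ f xs ys)) (sym (+-assoc _ _ _))

  ∑ₗ-concatMap : (f : B → Carrier) (g : A → List B) (xs : List A) →
                 ∑ₗ f (concatMap g xs) ≈ ∑ₗ (λ x → ∑ₗ f (g x)) xs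
  ∑ₗ-concatMap f g []       = refl
  ∑ₗ-concatMap f g (x ∷ xs) = trans (∑ₗ-++ f (g x) (concatMap g xs)) (+-congˡ (∑ₗ-concatMap f g xs))

  ∑ₗ-map : (f : B → Carrier) (g : A → B) (xs : List A) → ∑ₗ f (map g xs) ≡ ∑ₗ (f ∘ g) xs
  ∑ₗ-map f g xs = ≡.cong (sumR R) (≡.sym (map-∘ xs))

  ∑ₗ-allFin : (f : Fin n → Carrier) → ∑ₗ f (allFin n) ≡ sum f
  ∑ₗ-allFin f = foldr-map-tabulate _+_ 0# f id

  ∑ₗ-applyUpTo : (f : ℕ → Carrier) (g : ℕ → ℕ) (n : ℕ) →
                 ∑ₗ f (applyUpTo g n) ≡ ∑[ i < n ] f (g (toℕ i))
  ∑ₗ-applyUpTo f g zero    = ≡.refl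
  ∑ₗ-applyUpTo f g (suc n) = ≡.cong (f (g 0) +_) (∑ₗ-applyUpTo f (g ∘ suc) n)

  ∑ₗ-filterᵇ : (p : A → Bool) (f : A → Carrier) (xs : List A) →
               ∑ₗ f (filterᵇ p xs) ≈ ∑ₗ (λ x → guard (p x) (f x)) xs
  ∑ₗ-filterᵇ p f []       = refl
  ∑ₗ-filterᵇ p f (x ∷ xs) with p x
  ... | true  = +-congˡ (∑ₗ-filterᵇ p f xs)
  ... | false = trans (∑ₗ-filterᵇ p f xs) (sym (+-identityˡ _))

  ∑ₗ-∑-comm : (f : A → Fin m → Carrier) (xs : List A) →
              ∑ₗ (λ x → ∑[ j < m ] f x j) xs ≈ ∑[ j < m ] ∑ₗ (λ x → f x j) xs
  ∑ₗ-∑-comm {m = m} f []       = sym (sum-replicate-zero m)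
  ∑ₗ-∑-comm         f (x ∷ xs) = trans (+-congˡ (∑ₗ-∑-comm f xs)) (sym (∑-distrib-+ (f x) _))

  *-distribˡ-∑ₗ : (a : Carrier) (f : A → Carrier) (xs : List A) → a * ∑ₗ f xs ≈ ∑ₗ (λ x → a * f x) xs
  *-distribˡ-∑ₗ a f []       = zeroʳ a
  *-distribˡ-∑ₗ a f (x ∷ xs) = trans (distribˡ _ _ _) (+-congˡ (*-distribˡ-∑ₗ a f xs))

  -- allFuns builds (a ∷ g) by a pattern lambda, equal to a ∷ᶠ g only pointwise; hence
  -- the summands must respect _≗_.
  ∑ₗ-allFuns-suc : {f : (Fin (suc n) → Fin m) → Carrier} → f Preserves _≗_ ⟶ _≈_ →
                   ∑ₗ f (allFuns (suc n) m) ≈ ∑ₗ (λ g → ∑[ a < m ] f (a ∷ᶠ g)) (allFuns n m)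
  ∑ₗ-allFuns-suc {n} {m} {f} f-cong =
    trans (∑ₗ-concatMap f _ (allFuns n m)) (∑ₗ-cong (allFuns n m) λ g →
      trans (reflexive (≡.trans (∑ₗ-map f _ (allFin m)) (∑ₗ-allFin {n = m} _)))
            (sum-cong-≋ λ a → f-cong {y = a ∷ᶠ g} λ { fzero → ≡.refl ; (fsuc i) → ≡.refl }))

  ∑ₗ-allFuns-avoiding : ∀ n (a : Fin (suc m)) {f : (Fin n → Fin (suc m)) → Carrier} →
    f Preserves _≗_ ⟶ _≈_ →
    ∑ₗ (λ g → guard (avoidsᵇ a g) (f g)) (allFuns n (suc m)) ≈ ∑ₗ (λ h → f (punchIn a ∘ h)) (allFuns n m)
  ∑ₗ-allFuns-avoiding zero a f-cong = +-congʳ (f-cong λ ())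
  ∑ₗ-allFuns-avoiding {m} (suc n) a {f} f-cong = begin
    ∑ₗ (λ g → guard (avoidsᵇ a g) (f g)) (allFuns (suc n) (suc m))
      ≈⟨ ∑ₗ-allFuns-suc guarded-cong ⟩
    ∑ₗ (λ g → ∑[ b < suc m ] guard (not (does (a Fin.≟ b)) ∧ avoidsᵇ a g) (f (b ∷ᶠ g))) (allFuns n (suc m))
      ≈⟨ ∑ₗ-cong (allFuns n (suc m)) (λ g →
           trans (∑-guard-∧ʳ (λ b → not (does (a Fin.≟ b))) (avoidsᵇ a g) (λ b → f (b ∷ᶠ g)))
                 (guard-congʳ (avoidsᵇ a g) (∑-guard-≢ a (λ b → f (b ∷ᶠ g))))) ⟩
    ∑ₗ (λ g → guard (avoidsᵇ a g) (∑[ j < m ] f (punchIn a j ∷ᶠ g))) (allFuns n (suc m))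
      ≈⟨ ∑ₗ-allFuns-avoiding n a (λ g≗h → sum-cong-≋ {n = m} λ j → f-cong (∷ᶠ-congʳ g≗h)) ⟩
    ∑ₗ (λ h → ∑[ j < m ] f (punchIn a j ∷ᶠ (punchIn a ∘ h))) (allFuns n m)
      ≈⟨ ∑ₗ-cong (allFuns n m) (λ h → sum-cong-≋ {n = m} λ j → f-cong (punchIn-∷ᶠ j h)) ⟩
    ∑ₗ (λ h → ∑[ j < m ] f (punchIn a ∘ (j ∷ᶠ h))) (allFuns n m)
      ≈⟨ ∑ₗ-allFuns-suc (λ g≗h → f-cong (≡.cong (punchIn a) ∘ g≗h)) ⟨
    ∑ₗ (λ h → f (punchIn a ∘ h)) (allFuns (suc n) m) ∎
    where
    guarded-cong : (λ g → guard (avoidsᵇ a g) (f g)) Preserves _≗_ ⟶ _≈_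
    guarded-cong {g} {h} g≗h rewrite avoidsᵇ-cong a g≗h = guard-congʳ (avoidsᵇ a h) (f-cong g≗h)
    punchIn-∷ᶠ : (j : Fin m) (h : Fin n → Fin m) → (punchIn a j ∷ᶠ (punchIn a ∘ h)) ≗ punchIn a ∘ (j ∷ᶠ h)
    punchIn-∷ᶠ j h fzero    = ≡.refl
    punchIn-∷ᶠ j h (fsuc i) = ≡.refl
    ∷ᶠ-congʳ : ∀ {x} {g h : Fin n → Fin (suc m)} → g ≗ h → (x ∷ᶠ g) ≗ (x ∷ᶠ h)
    ∷ᶠ-congʳ g≗h fzero    = ≡.refl
    ∷ᶠ-congʳ g≗h (fsuc i) = g≗h i

  permTerm : (Fin n → Fin m → Carrier) → (Fin n → Fin m) → Carrier
  permTerm A f = guard (injectiveᵇ f) (∏ λ i → A i (f i))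

  permanent : (Fin n → Fin m → Carrier) → Carrier
  permanent {n} {m} A = ∑ₗ (permTerm A) (allFuns n m)

  permTerm-resp-≗ : (A : Fin n → Fin m → Carrier) → permTerm A Preserves _≗_ ⟶ _≈_
  permTerm-resp-≗ A {f} {g} f≗g rewrite injectiveᵇ-cong f≗g =
    guard-congʳ (injectiveᵇ g) (∏-cong λ i → reflexive (≡.cong (A i) (f≗g i)))

  permanent-cong : {A B : Fin n → Fin m → Carrier} → (∀ i j → A i j ≈ B i j) → permanent A ≈ permanent B
  permanent-cong {n} {m} A≈B = ∑ₗ-cong (allFuns n m) λ f → guard-congʳ (injectiveᵇ f) (∏-cong λ i → A≈B i (f i))

  minor : (Fin (suc n) → Fin (suc m) → Carrier) → Fin (suc m) → Fin n → Fin m → Carrier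
  minor A a i j = A (fsuc i) (punchIn a j)

  permTerm-∷ : (A : Fin (suc n) → Fin m → Carrier) (a : Fin m) (g : Fin n → Fin m) →
               permTerm A (a ∷ᶠ g) ≈ A fzero a * guard (avoidsᵇ a g) (permTerm (A ∘ fsuc) g)
  permTerm-∷ A a g rewrite injectiveᵇ-∷ a g with avoidsᵇ a g | injectiveᵇ g
  ... | true  | true  = refl
  ... | true  | false = sym (zeroʳ _)
  ... | false | _     = sym (zeroʳ _)

  permTerm-punchIn : (A : Fin (suc n) → Fin (suc m) → Carrier) (a : Fin (suc m)) (h : Fin n → Fin m) →
                     permTerm (A ∘ fsuc) (punchIn a ∘ h) ≡ permTerm (minor A a) h
  permTerm-punchIn A a h = ≡.cong (λ b → guard b (∏ λ i → minor A a i (h i))) (injectiveᵇ-punchIn a h)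

  permanent-expandFirstRow : (A : Fin (suc n) → Fin (suc m) → Carrier) →
                             permanent A ≈ ∑[ a < suc m ] (A fzero a * permanent (minor A a))
  permanent-expandFirstRow {n} {m} A = begin
    permanent A
      ≈⟨ ∑ₗ-allFuns-suc (permTerm-resp-≗ A) ⟩
    ∑ₗ (λ g → ∑[ a < suc m ] permTerm A (a ∷ᶠ g)) (allFuns n (suc m))
      ≈⟨ ∑ₗ-cong (allFuns n (suc m)) (λ g → sum-cong-≋ λ a → permTerm-∷ A a g) ⟩
    ∑ₗ (λ g → ∑[ a < suc m ] (A fzero a * restricted a g)) (allFuns n (suc m))
      ≈⟨ ∑ₗ-∑-comm (λ g a → A fzero a * restricted a g) (allFuns n (suc m)) ⟩
    ∑[ a < suc m ] ∑ₗ (λ g → A fzero a * restricted a g) (allFuns n (suc m))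
      ≈⟨ sum-cong-≋ column ⟩
    ∑[ a < suc m ] (A fzero a * permanent (minor A a)) ∎
    where
    restricted : Fin (suc m) → (Fin n → Fin (suc m)) → Carrier
    restricted a g = guard (avoidsᵇ a g) (permTerm (A ∘ fsuc) g)
    column : ∀ a → ∑ₗ (λ g → A fzero a * restricted a g) (allFuns n (suc m)) ≈ A fzero a * permanent (minor A a)
    column a = begin
      ∑ₗ (λ g → A fzero a * restricted a g) (allFuns n (suc m))
        ≈⟨ *-distribˡ-∑ₗ (A fzero a) (restricted a) (allFuns n (suc m)) ⟨
      A fzero a * ∑ₗ (restricted a) (allFuns n (suc m))
        ≈⟨ *-congˡ (∑ₗ-allFuns-avoiding n a (permTerm-resp-≗ (A ∘ fsuc))) ⟩
      A fzero a * ∑ₗ (λ h → permTerm (A ∘ fsuc) (punchIn a ∘ h)) (allFuns n m)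
        ≈⟨ *-congˡ (∑ₗ-cong (allFuns n m) λ h → reflexive (permTerm-punchIn A a h)) ⟩
      A fzero a * permanent (minor A a) ∎

  perm≈permanent : (A : Fin n → Fin n → Carrier) → perm R A ≈ permanent A
  perm≈permanent {n} A =
    trans (∑ₗ-filterᵇ isPermᵇ (λ σ → prodR R (map (λ i → A i (σ i)) (allFin n))) (allFuns n n))
          (∑ₗ-cong (allFuns n n) λ σ → reflexive
            (≡.cong₂ guard (isPermᵇ≡injectiveᵇ σ) (foldr-map-tabulate _*_ 1# (λ i → A i (σ i)) id)))

  perm-cong : {A B : Fin n → Fin n → Carrier} → (∀ i j → A i j ≈ B i j) → perm R A ≈ perm R B
  perm-cong {A = A} {B} A≈B = trans (perm≈permanent A) (trans (permanent-cong A≈B) (sym (perm≈permanent B)))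

  perm-expandFirstRow : (A : Fin (suc n) → Fin (suc n) → Carrier) →
                        perm R A ≈ ∑[ a < suc n ] (A fzero a * perm R (minor A a))
  perm-expandFirstRow {n} A = trans (perm≈permanent A) (trans (permanent-expandFirstRow A)
    (sum-cong-≋ λ a → *-congˡ {A fzero a} (sym (perm≈permanent (minor A a)))))

  perm-1×1 : (A : Fin 1 → Fin 1 → Carrier) → perm R A ≈ A fzero fzero
  perm-1×1 A = trans (+-identityʳ _) (*-identityʳ _)

  module _ (t : ℕ → Carrier) (ω : ℕ → ℤ) where
    private
      H : (m : ℕ) → Fin m → Fin m → Carrier
      H = Hplus R t ω

    module _ {m : ℕ} (i j : Fin m) where
      Hplus-lastRow : suc (toℕ i) ≡ m → H m i j ≡ intR R (ω (m ∸ toℕ j)) * t (m ∸ toℕ j)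
      Hplus-lastRow e rewrite dec-yes-irr (suc (toℕ i) ≟ m) ≡-irrelevant e = ≡.refl

      Hplus-lower : suc (toℕ i) ≢ m → toℕ j ≤ toℕ i → H m i j ≡ t (suc (toℕ i ∸ toℕ j))
      Hplus-lower ne le
        rewrite dec-no (suc (toℕ i) ≟ m) ne | dec-yes-irr (toℕ j ≤? toℕ i) ≤-irrelevant le = ≡.refl

      Hplus-superdiagonal : suc (toℕ i) ≢ m → ¬ toℕ j ≤ toℕ i → toℕ j ≡ suc (toℕ i) → H m i j ≡ 1#
      Hplus-superdiagonal ne nle e
        rewrite dec-no (suc (toℕ i) ≟ m) ne | dec-no (toℕ j ≤? toℕ i) nle
              | dec-yes-irr (toℕ j ≟ suc (toℕ i)) ≡-irrelevant e = ≡.refl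

      Hplus-upper : suc (toℕ i) ≢ m → ¬ toℕ j ≤ toℕ i → toℕ j ≢ suc (toℕ i) → H m i j ≡ 0#
      Hplus-upper ne nle ne′
        rewrite dec-no (suc (toℕ i) ≟ m) ne | dec-no (toℕ j ≤? toℕ i) nle
              | dec-no (toℕ j ≟ suc (toℕ i)) ne′ = ≡.refl

    -- Abstracting the tests makes the right-hand side H m i j compute.
    Hplus-shift : ∀ m (i j : Fin m) → H (suc m) (fsuc i) (fsuc j) ≡ H m i j
    Hplus-shift m i j with suc (toℕ i) ≟ m
    ... | yes e = Hplus-lastRow (fsuc i) (fsuc j) (≡.cong suc e)
    ... | no ne with toℕ j ≤? toℕ i
    ...   | yes le = Hplus-lower (fsuc i) (fsuc j) (ne ∘ suc-injective) (s≤s le)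
    ...   | no nle with toℕ j ≟ suc (toℕ i)
    ...     | yes e   = Hplus-superdiagonal (fsuc i) (fsuc j) (ne ∘ suc-injective) (nle ∘ ≤-pred) (≡.cong suc e)
    ...     | no ne′ = Hplus-upper (fsuc i) (fsuc j) (ne ∘ suc-injective) (nle ∘ ≤-pred) (ne′ ∘ suc-injective)

    withFirstColumn : (Fin m → Carrier) → Fin m → Fin m → Carrier
    withFirstColumn c i fzero    = c i
    withFirstColumn c i (fsuc j) = H _ i (fsuc j)

    perm-withFirstColumn-step : (c : Fin (suc (suc m)) → Carrier) →
      perm R (withFirstColumn c) ≈ c fzero * Mseq R t ω (suc m) + perm R (withFirstColumn (c ∘ fsuc))
    perm-withFirstColumn-step {m} c = begin
      perm R Hc
        ≈⟨ perm-expandFirstRow Hc ⟩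
      Hc fzero fzero * perm R (minor Hc fzero)
        + (Hc fzero (fsuc fzero) * perm R (minor Hc (fsuc fzero))
           + ∑[ a < m ] (Hc fzero (fsuc (fsuc a)) * perm R (minor Hc (fsuc (fsuc a)))))
        ≈⟨ +-cong (*-congˡ (perm-cong minor₀))
                  (+-cong (*-cong (reflexive entry₁) (perm-cong minor₁)) rest-vanishes) ⟩
      c fzero * Mseq R t ω (suc m) + (1# * perm R (withFirstColumn (c ∘ fsuc)) + 0#)
        ≈⟨ +-congˡ (trans (+-identityʳ _) (*-identityˡ _)) ⟩
      c fzero * Mseq R t ω (suc m) + perm R (withFirstColumn (c ∘ fsuc)) ∎
      where
      Hc : Fin (suc (suc m)) → Fin (suc (suc m)) → Carrier
      Hc = withFirstColumn c
      minor₀ : ∀ i j → minor Hc fzero i j ≈ H (suc m) i j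
      minor₀ i j = reflexive (Hplus-shift (suc m) i j)
      minor₁ : ∀ i j → minor Hc (fsuc fzero) i j ≈ withFirstColumn (c ∘ fsuc) i j
      minor₁ i fzero    = refl
      minor₁ i (fsuc j) = reflexive (Hplus-shift (suc m) i (fsuc j))
      entry₁ : Hc fzero (fsuc fzero) ≡ 1#
      entry₁ = Hplus-superdiagonal {suc (suc m)} fzero (fsuc fzero) (λ ()) (λ ()) ≡.refl
      vanishes : ∀ a → Hc fzero (fsuc (fsuc a)) * perm R (minor Hc (fsuc (fsuc a))) ≈ 0#
      vanishes a = trans (*-congʳ (reflexive (Hplus-upper fzero (fsuc (fsuc a)) (λ ()) (λ ()) (λ ())))) (zeroˡ _)
      rest-vanishes : ∑[ a < m ] (Hc fzero (fsuc (fsuc a)) * perm R (minor Hc (fsuc (fsuc a)))) ≈ 0#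
      rest-vanishes = trans (sum-cong-≋ vanishes) (sum-replicate-zero m)

    perm-withFirstColumn : ∀ m (c : Fin (suc m) → Carrier) →
      perm R (withFirstColumn c) ≈ ∑[ i < m ] (c (inject₁ i) * Mseq R t ω (m ∸ toℕ i)) + c (fromℕ m)
    perm-withFirstColumn zero    c = trans (perm-1×1 (withFirstColumn c)) (sym (+-identityˡ (c fzero)))
    perm-withFirstColumn (suc m) c = trans (perm-withFirstColumn-step c)
      (trans (+-congˡ (perm-withFirstColumn m (c ∘ fsuc))) (sym (+-assoc _ _ _)))

    Mseq-recurrence : ∀ m → Mseq R t ω (suc (suc m)) ≈ recRHS R t ω (suc (suc m))
    Mseq-recurrence m = begin
      perm R (H N)
        ≈⟨ perm-cong {A = H N} {withFirstColumn (λ i → H N i fzero)}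
                     (λ { i fzero → refl ; i (fsuc j) → refl }) ⟩
      perm R (withFirstColumn (λ i → H N i fzero))
        ≈⟨ perm-withFirstColumn (suc m) _ ⟩
      ∑[ i < suc m ] (H N (inject₁ i) fzero * Mseq R t ω (suc m ∸ toℕ i)) + H N (fromℕ (suc m)) fzero
        ≈⟨ +-cong (sum-cong-≋ λ i → *-congʳ {Mseq R t ω (suc m ∸ toℕ i)} (reflexive (firstColumn i)))
                  (reflexive (Hplus-lastRow (fromℕ (suc m)) fzero (≡.cong suc (Fin.toℕ-fromℕ (suc m))))) ⟩
      ∑[ i < suc m ] (t (suc (toℕ i)) * Mseq R t ω (suc m ∸ toℕ i)) + intR R (ω N) * t N
        ≡⟨ ≡.cong (_+ intR R (ω N) * t N)
                  (∑ₗ-applyUpTo (λ i → t (suc i) * Mseq R t ω (N ∸ suc i)) id (suc m)) ⟨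
      recRHS R t ω N ∎
      where
      N : ℕ
      N = suc (suc m)
      firstColumn : (i : Fin (suc m)) → H N (inject₁ i) fzero ≡ t (suc (toℕ i))
      firstColumn i = ≡.trans
        (Hplus-lower (inject₁ i) fzero (λ e → Fin.toℕ-inject₁-≢ i (≡.sym (suc-injective e))) z≤n)
        (≡.cong (t ∘ suc) (Fin.toℕ-inject₁ i))

-- The recurrence holds for every t.
lemma15 : {c ℓ : Level} (R : CommutativeRing c ℓ) (k : ℕ) → 1 ≤ k →
    (t : ℕ → CommutativeRing.Carrier R) →
    (∀ j → k < j → CommutativeRing._≈_ R (t j) (CommutativeRing.0# R)) →
    (ω : ℕ → ℤ) → (n : ℕ) → 2 ≤ n →
    CommutativeRing._≈_ R (Mseq R t ω n) (recRHS R t ω n)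
lemma15 R _ _ t _ ω (suc (suc n)) (s≤s (s≤s z≤n)) = Mseq-recurrence R t ω n
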